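{- Let $\mathcal{P},\mathcal{Q}$ be partitions of the same finite set. If $\mathcal{Q}\prec_\delta\mathcal{P}$, then there exist $P\in\mathcal{P}$ and a set $Q$ that is a union of members of $\mathcal{Q}$ such that $|P\triangle Q|\le 3\delta|P|$.
   Context: For sets $S,T$ write $S\subseteq_\beta T$ if $|S\setminus T|<\beta|S|$; for a partition $\mathcal{P}$ write $S\in_\beta\mathcal{P}$ if $S\subseteq_\beta P$ for some $P\in\mathcal{P}$. For partitions $\mathcal{P},\mathcal{Q}$ of the same set of size $n$, $\mathcal{Q}\prec_\beta\mathcal{P}$ means $\sum_{Q\in\mathcal{Q},\,Q\notin_\beta\mathcal{P}}|Q|\le\beta n$.
   Formalization: The parameter δ ranges over the rationals. -}

module Defs where

open import Data.Nat using (ℕ; zero; suc)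
open import Data.Fin using (Fin)
open import Data.Fin.Subset using (Subset; _∈_; _∩_; _∪_; _─_; ∣_∣; ⋃; Nonempty; Empty)
open import Data.Fin.Subset.Properties using (_∈?_)
open import Data.Fin.Properties using (any?)
open import Data.List using (List; map; filter; allFin)
open import Data.Nat.ListAction using (sum)
open import Data.Integer using (+_)
open import Data.Rational using (ℚ; _/_; _<_; _≤_; _*_)
open import Data.Rational.Properties using (_<?_)
open import Data.Product using (∃; ∃-syntax)
open import Relation.Binary.PropositionalEquality using (_≢_)
open import Relation.Nullary using (Dec; does)
open import Data.Bool using (if_then_else_)

toℚ : ℕ → ℚ
toℚ m = (+ m) / 1

record Partition (n : ℕ) : Set where
  field
    k        : ℕ
    block    : Fin k → Subset n
    nonempty : ∀ i → Nonempty (block i)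
    disjoint : ∀ i j → i ≢ j → Empty (block i ∩ block j)
    cover    : ∀ x → ∃[ i ] x ∈ block i

open Partition public

_⊆⟨_⟩_ : ∀ {n} → Subset n → ℚ → Subset n → Set
S ⊆⟨ β ⟩ T = toℚ ∣ S ─ T ∣ < β * toℚ ∣ S ∣

_⊆⟨_⟩?_ : ∀ {n} (S : Subset n) (β : ℚ) (T : Subset n) → Dec (S ⊆⟨ β ⟩ T)
S ⊆⟨ β ⟩? T = toℚ ∣ S ─ T ∣ <? β * toℚ ∣ S ∣

_∈⟨_⟩_ : ∀ {n} → Subset n → ℚ → Partition n → Set
S ∈⟨ β ⟩ 𝒫 = ∃[ i ] S ⊆⟨ β ⟩ block 𝒫 i

_∈⟨_⟩?_ : ∀ {n} (S : Subset n) (β : ℚ) (𝒫 : Partition n) → Dec (S ∈⟨ β ⟩ 𝒫)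
S ∈⟨ β ⟩? 𝒫 = any? (λ i → S ⊆⟨ β ⟩? block 𝒫 i)

_≺⟨_⟩_ : ∀ {n} → Partition n → ℚ → Partition n → Set
_≺⟨_⟩_ {n} 𝒬 β 𝒫 =
  toℚ (sum (map (λ j → if does (block 𝒬 j ∈⟨ β ⟩? 𝒫) then 0 else ∣ block 𝒬 j ∣)
                (allFin (k 𝒬))))
  ≤ β * toℚ n

unionOf : ∀ {n} (𝒬 : Partition n) → Subset (k 𝒬) → Subset n
unionOf 𝒬 I = ⋃ (map (block 𝒬) (filter (_∈? I) (allFin (k 𝒬))))

_△_ : ∀ {n} → Subset n → Subset n → Subset n
A △ B = (A ─ B) ∪ (B ─ A)

module Submission where

-- Send each block Q of 𝒬 with Q ⊆_δ P for some block P of 𝒫 to such a P, and let U_P (gathered P) be the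
-- union of the blocks sent to P. A point lies in P △ U_P only for P its own block or the block
-- its 𝒬-block was sent to, and for neither if the two agree. Double counting therefore gives
--   Σ_P |P △ U_P| ≤ 2 Σ_{Q sent to P} |Q ∖ P| + Σ_{Q not sent} |Q| ≤ 2δn + δn = 3δ Σ_P |P|,
-- so some block P satisfies |P △ U_P| ≤ 3δ|P|.

open import Defs
open import Data.Nat using (ℕ; _≤_)
open import Data.Fin.Subset using (Subset; ∣_∣)
open import Data.Integer using (+_)
open import Data.Rational using (ℚ; _/_; _*_) renaming (_≤_ to _≤ℚ_)
open import Data.Product using (∃; ∃-syntax)

open import Algebra.Bundles using (CommutativeRing)
open import Data.Bool using (if_then_else_)
open import Data.Empty using (⊥-elim)
open import Data.Fin using (Fin; zero; suc; fromℕ<)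
open import Data.Fin.Properties using (_≟_; any?; suc-injective)
open import Data.Fin.Subset using (_∈_; _∉_; _─_; ⋃; ⊤; inside; outside)
open import Data.Fin.Subset.Properties
  using (_∈?_; x∈p∩q⁺; x∈p∪q⁺; x∈p∪q⁻; ∉⊥; x∈p∧x∉q⇒x∈p─q; ∈⊤; ∣⊤∣≡n)
import Data.Integer as ℤ
import Data.Integer.Properties as ℤP
open import Data.List as List using (List; map; filter; allFin; tabulate)
open import Data.List.Properties using (map-tabulate)
import Data.List.Membership.Propositional as List
open import Data.List.Membership.Propositional.Properties
  using (∈-filter⁺; ∈-filter⁻; ∈-map⁺; ∈-map⁻; ∈-allFin)
open import Data.List.Relation.Unary.Any using (here; there)
open import Data.Maybe using (Maybe; just; nothing; maybe′)
open import Data.Maybe.Properties using (≡-dec; just-injective)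
import Data.Nat as ℕ
import Data.Nat.ListAction as ListAction
import Data.Nat.Properties as ℕP
open import Data.Nat.Coprimality using (1-coprimeTo) renaming (sym to coprime-sym)
open import Data.Product using (_,_; proj₁; proj₂; _×_)
open import Data.Rational using (mkℚ; 0ℚ; 1ℚ; _<_; *≤*; positive; nonNegative) renaming (_+_ to _+ℚ_)
import Data.Rational.Properties as ℚP
open import Data.Sum using (_⊎_; inj₁; inj₂)
open import Data.Vec as Vec using (_∷_; [])
open import Data.Vec.Properties using (lookup∘tabulate; []=⇒lookup; lookup⇒[]=)
open import Function using (_∘_; id)
open import Relation.Binary.PropositionalEquality
open import Relation.Nullary using (Dec; yes; no; does; ¬_)
open import Relation.Nullary.Decidable using (dec-true)

import Algebra.Properties.Semiring.Sum as SemiringSum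
open SemiringSum ℕP.+-*-semiring
  using (sum; sum-syntax; ∑-comm; ∑-distrib-+; sum-cong-≗; sum-replicate-zero; *-distribˡ-sum)
module ℚ∑ = SemiringSum (CommutativeRing.semiring ℚP.+-*-commutativeRing)

𝟙 : ∀ {a} {A : Set a} → Dec A → ℕ
𝟙 a? = if does a? then 1 else 0

𝟙-yes : ∀ {a} {A : Set a} (a? : Dec A) → A → 𝟙 a? ≡ 1
𝟙-yes (yes _) _ = refl
𝟙-yes (no ¬a) a = ⊥-elim (¬a a)

𝟙-no : ∀ {a} {A : Set a} (a? : Dec A) → ¬ A → 𝟙 a? ≡ 0
𝟙-no (yes a) ¬a = ⊥-elim (¬a a)
𝟙-no (no _) _ = refl

𝟙-mono : ∀ {a b} {A : Set a} {B : Set b} (a? : Dec A) (b? : Dec B) → (A → B) → 𝟙 a? ≤ 𝟙 b?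
𝟙-mono (yes a) b? A⇒B = ℕP.≤-reflexive (sym (𝟙-yes b? (A⇒B a)))
𝟙-mono (no _) _ _ = ℕ.z≤n

𝟙-≤-+ : ∀ {a b c} {A : Set a} {B : Set b} {C : Set c} (a? : Dec A) (b? : Dec B) (c? : Dec C) →
        (A → B ⊎ C) → 𝟙 a? ≤ 𝟙 b? ℕ.+ 𝟙 c?
𝟙-≤-+ (no _) _ _ _ = ℕ.z≤n
𝟙-≤-+ (yes a) b? c? A⇒B⊎C with A⇒B⊎C a
... | inj₁ b rewrite 𝟙-yes b? b = ℕ.s≤s ℕ.z≤n
... | inj₂ c rewrite 𝟙-yes c? c = ℕP.m≤n+m 1 (𝟙 b?)

sum-mono-≤ : ∀ {k} {f g : Fin k → ℕ} → (∀ i → f i ≤ g i) → sum f ≤ sum g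
sum-mono-≤ {ℕ.zero} _ = ℕ.z≤n
sum-mono-≤ {ℕ.suc k} f≤g = ℕP.+-mono-≤ (f≤g zero) (sum-mono-≤ (f≤g ∘ suc))

sum-zero : ∀ {k} (f : Fin k → ℕ) → (∀ i → f i ≡ 0) → sum f ≡ 0
sum-zero {k} _ f≡0 = trans (sum-cong-≗ f≡0) (sum-replicate-zero k)

sum-single : ∀ {k} (f : Fin k → ℕ) (a : Fin k) → (∀ i → i ≢ a → f i ≡ 0) → sum f ≡ f a
sum-single f zero f≡0 =
  trans (cong (f zero ℕ.+_) (sum-zero (f ∘ suc) (λ i → f≡0 (suc i) λ ()))) (ℕP.+-identityʳ (f zero))
sum-single f (suc a) f≡0 =
  trans (cong (ℕ._+ sum (f ∘ suc)) (f≡0 zero λ ()))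
        (sum-single (f ∘ suc) a (λ i i≢a → f≡0 (suc i) (i≢a ∘ suc-injective)))

sum-𝟙≟ : ∀ {k} (a : Fin k) → ∑[ i < k ] 𝟙 (i ≟ a) ≡ 1
sum-𝟙≟ a = trans (sum-single (λ i → 𝟙 (i ≟ a)) a (λ i → 𝟙-no (i ≟ a))) (𝟙-yes (a ≟ a) refl)

module _ {k p} {A : Fin k → Set p} (A? : ∀ i → Dec (A i)) where

  sum-𝟙-none : (∀ i → ¬ A i) → ∑[ i < k ] 𝟙 (A? i) ≡ 0
  sum-𝟙-none ¬A = sum-zero _ (λ i → 𝟙-no (A? i) (¬A i))

  sum-𝟙-≤1 : (a : Fin k) → (∀ i → A i → i ≡ a) → ∑[ i < k ] 𝟙 (A? i) ≤ 1
  sum-𝟙-≤1 a A⇒a = begin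
    ∑[ i < k ] 𝟙 (A? i)     ≤⟨ sum-mono-≤ (λ i → 𝟙-mono (A? i) (i ≟ a) (A⇒a i)) ⟩
    ∑[ i < k ] 𝟙 (i ≟ a)    ≡⟨ sum-𝟙≟ a ⟩
    1                       ∎
    where open ℕP.≤-Reasoning

  sum-𝟙-≤2 : (a b : Fin k) → (∀ i → A i → i ≡ a ⊎ i ≡ b) → ∑[ i < k ] 𝟙 (A? i) ≤ 2
  sum-𝟙-≤2 a b A⇒a⊎b = begin
    ∑[ i < k ] 𝟙 (A? i)
      ≤⟨ sum-mono-≤ (λ i → 𝟙-≤-+ (A? i) (i ≟ a) (i ≟ b) (A⇒a⊎b i)) ⟩
    ∑[ i < k ] (𝟙 (i ≟ a) ℕ.+ 𝟙 (i ≟ b))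
      ≡⟨ ∑-distrib-+ (λ i → 𝟙 (i ≟ a)) (λ i → 𝟙 (i ≟ b)) ⟩
    ∑[ i < k ] 𝟙 (i ≟ a) ℕ.+ ∑[ i < k ] 𝟙 (i ≟ b)
      ≡⟨ cong₂ ℕ._+_ (sum-𝟙≟ a) (sum-𝟙≟ b) ⟩
    2 ∎
    where open ℕP.≤-Reasoning

∣p∣≡sum-𝟙∈ : ∀ {n} (p : Subset n) → ∣ p ∣ ≡ ∑[ x < n ] 𝟙 (x ∈? p)
∣p∣≡sum-𝟙∈ [] = refl
∣p∣≡sum-𝟙∈ (inside ∷ p) = cong ℕ.suc (∣p∣≡sum-𝟙∈ p)
∣p∣≡sum-𝟙∈ (outside ∷ p) = ∣p∣≡sum-𝟙∈ p

sum-allFin : ∀ {k} (f : Fin k → ℕ) → ListAction.sum (map f (allFin k)) ≡ sum f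
sum-allFin f = trans (cong ListAction.sum (map-tabulate id f)) (sum-tabulate f)
  where
  sum-tabulate : ∀ {k} (g : Fin k → ℕ) → ListAction.sum (tabulate g) ≡ sum g
  sum-tabulate {ℕ.zero} g = refl
  sum-tabulate {ℕ.suc k} g = cong (g zero ℕ.+_) (sum-tabulate (g ∘ suc))

x∈p─q⁻ : ∀ {n} (p q : Subset n) {x} → x ∈ p ─ q → x ∈ p × x ∉ q
x∈p─q⁻ (_ ∷ p) (outside ∷ q) Vec.here = Vec.here , λ ()
x∈p─q⁻ (_ ∷ p) (_ ∷ q) (Vec.there x∈p─q) with x∈p─q⁻ p q x∈p─q
... | x∈p , x∉q = Vec.there x∈p , λ { (Vec.there x∈q) → x∉q x∈q }

x∈p△q⁻ : ∀ {n} (p q : Subset n) {x} → x ∈ p △ q → (x ∈ p × x ∉ q) ⊎ (x ∈ q × x ∉ p)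
x∈p△q⁻ p q x∈p△q with x∈p∪q⁻ (p ─ q) (q ─ p) x∈p△q
... | inj₁ x∈p─q = inj₁ (x∈p─q⁻ p q x∈p─q)
... | inj₂ x∈q─p = inj₂ (x∈p─q⁻ q p x∈q─p)

x∈⋃⁻ : ∀ {n} (ps : List (Subset n)) {x} → x ∈ ⋃ ps → ∃[ p ] p List.∈ ps × x ∈ p
x∈⋃⁻ List.[] x∈⊥ = ⊥-elim (∉⊥ x∈⊥)
x∈⋃⁻ (p List.∷ ps) x∈⋃ with x∈p∪q⁻ p (⋃ ps) x∈⋃
... | inj₁ x∈p = p , here refl , x∈p
... | inj₂ x∈⋃ps with x∈⋃⁻ ps x∈⋃ps
...   | q , q∈ps , x∈q = q , there q∈ps , x∈q

x∈⋃⁺ : ∀ {n} {ps : List (Subset n)} {p x} → p List.∈ ps → x ∈ p → x ∈ ⋃ ps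
x∈⋃⁺ (here refl) x∈p = x∈p∪q⁺ (inj₁ x∈p)
x∈⋃⁺ (there p∈ps) x∈p = x∈p∪q⁺ (inj₂ (x∈⋃⁺ p∈ps x∈p))

module _ {n} (R : Partition n) where

  blockOf : Fin n → Fin (k R)
  blockOf x = proj₁ (cover R x)

  ∈-blockOf : ∀ x → x ∈ block R (blockOf x)
  ∈-blockOf x = proj₂ (cover R x)

  blockOf-unique : ∀ {x i} → x ∈ block R i → i ≡ blockOf x
  blockOf-unique {x} {i} x∈i with i ≟ blockOf x
  ... | yes i≡ = i≡
  ... | no i≢ = ⊥-elim (disjoint R i (blockOf x) i≢ (x , x∈p∩q⁺ (x∈i , ∈-blockOf x)))

  sum-over-blocks : (F : Fin (k R) → Fin n → ℕ) → (∀ i x → x ∉ block R i → F i x ≡ 0) →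
                    ∑[ i < k R ] ∑[ x < n ] F i x ≡ ∑[ x < n ] F (blockOf x) x
  sum-over-blocks F F-outside = begin
    ∑[ i < k R ] ∑[ x < n ] F i x  ≡⟨ ∑-comm F ⟩
    ∑[ x < n ] ∑[ i < k R ] F i x  ≡⟨ sum-cong-≗ (λ x → sum-single (λ i → F i x) (blockOf x) (F-outside-at x)) ⟩
    ∑[ x < n ] F (blockOf x) x     ∎
    where
    open ≡-Reasoning
    F-outside-at : ∀ x i → i ≢ blockOf x → F i x ≡ 0
    F-outside-at x i i≢ = F-outside i x (i≢ ∘ blockOf-unique)

  sum-∣block∣ : ∑[ i < k R ] ∣ block R i ∣ ≡ n
  sum-∣block∣ = begin
    ∑[ i < k R ] ∣ block R i ∣
      ≡⟨ sum-cong-≗ (λ i → ∣p∣≡sum-𝟙∈ (block R i)) ⟩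
    ∑[ i < k R ] ∑[ x < n ] 𝟙 (x ∈? block R i)
      ≡⟨ sum-over-blocks _ (λ i x → 𝟙-no (x ∈? block R i)) ⟩
    ∑[ x < n ] 𝟙 (x ∈? block R (blockOf x))
      ≡⟨ sum-cong-≗ (λ x → trans (𝟙-∈-blockOf x) (sym (𝟙-yes (x ∈? ⊤) ∈⊤))) ⟩
    ∑[ x < n ] 𝟙 (x ∈? ⊤)
      ≡⟨ ∣p∣≡sum-𝟙∈ (⊤ {n}) ⟨
    ∣ ⊤ {n} ∣
      ≡⟨ ∣⊤∣≡n n ⟩
    n ∎
    where
    open ≡-Reasoning
    𝟙-∈-blockOf : ∀ x → 𝟙 (x ∈? block R (blockOf x)) ≡ 1
    𝟙-∈-blockOf x = 𝟙-yes (x ∈? block R (blockOf x)) (∈-blockOf x)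

  ∈-unionOf⁻ : ∀ {I x} → x ∈ unionOf R I → blockOf x ∈ I
  ∈-unionOf⁻ {I} x∈U with x∈⋃⁻ (map (block R) (filter (_∈? I) (allFin (k R)))) x∈U
  ... | _ , p∈ , x∈p with ∈-map⁻ (block R) p∈
  ...   | j , j∈ , refl = subst (_∈ I) (blockOf-unique x∈p) (proj₂ (∈-filter⁻ (_∈? I) {xs = allFin (k R)} j∈))

  ∈-unionOf⁺ : ∀ {I x} → blockOf x ∈ I → x ∈ unionOf R I
  ∈-unionOf⁺ {I} {x} bx∈I =
    x∈⋃⁺ (∈-map⁺ (block R) (∈-filter⁺ (_∈? I) (∈-allFin (blockOf x)) bx∈I)) (∈-blockOf x)

toℚ≡mkℚ : ∀ m → toℚ m ≡ mkℚ (+ m) 0 (coprime-sym (1-coprimeTo m))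
toℚ≡mkℚ m = ℚP.normalize-coprime (coprime-sym (1-coprimeTo m))

toℚ-+ : ∀ a b → toℚ (a ℕ.+ b) ≡ toℚ a +ℚ toℚ b
toℚ-+ a b rewrite toℚ≡mkℚ a | toℚ≡mkℚ b =
  cong (_/ 1) (sym (cong₂ ℤ._+_ (ℤP.*-identityʳ (+ a)) (ℤP.*-identityʳ (+ b))))

toℚ-mono-≤ : ∀ {a b} → a ≤ b → toℚ a ≤ℚ toℚ b
toℚ-mono-≤ {a} {b} a≤b rewrite toℚ≡mkℚ a | toℚ≡mkℚ b =
  *≤* (subst₂ ℤ._≤_ (sym (ℤP.*-identityʳ (+ a))) (sym (ℤP.*-identityʳ (+ b))) (ℤ.+≤+ a≤b))

toℚ-nonNeg : ∀ m → 0ℚ ≤ℚ toℚ m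
toℚ-nonNeg m = toℚ-mono-≤ {0} {m} ℕ.z≤n

toℚ-pos : ∀ m → 0 ℕ.< m → 0ℚ < toℚ m
toℚ-pos (ℕ.suc m) _ rewrite toℚ≡mkℚ (ℕ.suc m) = ℚP.positive⁻¹ _

toℚ-sum : ∀ {k} (f : Fin k → ℕ) → toℚ (sum f) ≡ ℚ∑.sum (toℚ ∘ f)
toℚ-sum {ℕ.zero} f = refl
toℚ-sum {ℕ.suc k} f = trans (toℚ-+ (f zero) (sum (f ∘ suc))) (cong (toℚ (f zero) +ℚ_) (toℚ-sum (f ∘ suc)))

*-toℚ-sum : ∀ {k} c (f : Fin k → ℕ) → c * toℚ (sum f) ≡ ℚ∑.sum (λ i → c * toℚ (f i))
*-toℚ-sum c f = trans (cong (c *_) (toℚ-sum f)) (ℚ∑.*-distribˡ-sum c (toℚ ∘ f))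

sumℚ-mono-≤ : ∀ {k} {f g : Fin k → ℚ} → (∀ i → f i ≤ℚ g i) → ℚ∑.sum f ≤ℚ ℚ∑.sum g
sumℚ-mono-≤ {ℕ.zero} _ = ℚP.≤-refl
sumℚ-mono-≤ {ℕ.suc k} f≤g = ℚP.+-mono-≤ (f≤g zero) (sumℚ-mono-≤ (f≤g ∘ suc))

sumℚ-mono-< : ∀ {k} {f g : Fin (ℕ.suc k) → ℚ} → (∀ i → f i < g i) → ℚ∑.sum f < ℚ∑.sum g
sumℚ-mono-< f<g = ℚP.+-mono-<-≤ (f<g zero) (sumℚ-mono-≤ (ℚP.<⇒≤ ∘ f<g ∘ suc))

∀-≤-scaled⇒sum-≤-scaled : ∀ {k} c (a b : Fin k → ℕ) → (∀ i → toℚ (a i) ≤ℚ c * toℚ (b i)) →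
                   toℚ (sum a) ≤ℚ c * toℚ (sum b)
∀-≤-scaled⇒sum-≤-scaled c a b a≤cb = begin
  toℚ (sum a)                   ≡⟨ toℚ-sum a ⟩
  ℚ∑.sum (toℚ ∘ a)              ≤⟨ sumℚ-mono-≤ a≤cb ⟩
  ℚ∑.sum (λ i → c * toℚ (b i))  ≡⟨ *-toℚ-sum c b ⟨
  c * toℚ (sum b)               ∎
  where open ℚP.≤-Reasoning

sum-≤-scaled⇒∃-≤-scaled : ∀ {k} c (a b : Fin k → ℕ) → Fin k → toℚ (sum a) ≤ℚ c * toℚ (sum b) →
                  ∃[ i ] toℚ (a i) ≤ℚ c * toℚ (b i)
sum-≤-scaled⇒∃-≤-scaled {ℕ.suc k} c a b _ a≤cb with any? (λ i → toℚ (a i) ℚP.≤? c * toℚ (b i))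
... | yes found = found
... | no none = ⊥-elim (ℚP.<-irrefl refl (ℚP.<-≤-trans cb<a a≤cb))
  where
  open ℚP.≤-Reasoning
  cb<a : c * toℚ (sum b) < toℚ (sum a)
  cb<a = begin-strict
    c * toℚ (sum b)               ≡⟨ *-toℚ-sum c b ⟩
    ℚ∑.sum (λ i → c * toℚ (b i))  <⟨ sumℚ-mono-< (λ i → ℚP.≰⇒> (λ a≤ → none (i , a≤))) ⟩
    ℚ∑.sum (toℚ ∘ a)              ≡⟨ toℚ-sum a ⟨
    toℚ (sum a)                   ∎

nonNeg-from-scaled : ∀ {c q} → 0ℚ < q → 0ℚ ≤ℚ c * q → 0ℚ ≤ℚ c
nonNeg-from-scaled {c} {q} q>0 0≤cq =
  ℚP.*-cancelʳ-≤-pos q {{positive q>0}} (subst (_≤ℚ c * q) (sym (ℚP.*-zeroˡ q)) 0≤cq)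

select : ∀ {m p} {A : Fin m → Set p} → (∀ j → Dec (A j)) → Subset m
select A? = Vec.tabulate (λ j → does (A? j))

module _ {m p} {A : Fin m → Set p} (A? : ∀ j → Dec (A j)) where

  ∈-select⁻ : ∀ {j} → j ∈ select A? → A j
  ∈-select⁻ {j} j∈ with A? j | trans (sym (lookup∘tabulate _ j)) ([]=⇒lookup j∈)
  ... | yes a | _ = a
  ... | no _ | ()

  ∈-select⁺ : ∀ {j} → A j → j ∈ select A?
  ∈-select⁺ {j} a = lookup⇒[]= j _ (trans (lookup∘tabulate _ j) (dec-true (A? j) a))

module HomeAssignment {n} (𝒫 𝒬 : Partition n) (home : Fin (k 𝒬) → Maybe (Fin (k 𝒫))) where

  homed? : ∀ i j → Dec (home j ≡ just i)
  homed? i j = ≡-dec _≟_ (home j) (just i)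

  homedAt : Fin (k 𝒫) → Subset (k 𝒬)
  homedAt i = select (homed? i)

  gathered : Fin (k 𝒫) → Subset n
  gathered i = unionOf 𝒬 (homedAt i)

  ∈-gathered⁻ : ∀ {i x} → x ∈ gathered i → home (blockOf 𝒬 x) ≡ just i
  ∈-gathered⁻ {i} x∈U = ∈-select⁻ (homed? i) (∈-unionOf⁻ 𝒬 x∈U)

  ∈-gathered⁺ : ∀ {i x} → home (blockOf 𝒬 x) ≡ just i → x ∈ gathered i
  ∈-gathered⁺ {i} homed = ∈-unionOf⁺ 𝒬 (∈-select⁺ (homed? i) homed)

  misplaced : Fin (k 𝒬) → ℕ
  misplaced j = maybe′ (λ i → ∣ block 𝒬 j ─ block 𝒫 i ∣) 0 (home j)

  unhomed : Fin (k 𝒬) → ℕ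
  unhomed j = maybe′ (λ _ → 0) ∣ block 𝒬 j ∣ (home j)

  misplacedAt : Fin (k 𝒬) → Fin n → ℕ
  misplacedAt j x = maybe′ (λ i → 𝟙 (x ∈? block 𝒬 j ─ block 𝒫 i)) 0 (home j)

  unhomedAt : Fin (k 𝒬) → Fin n → ℕ
  unhomedAt j x = maybe′ (λ _ → 0) (𝟙 (x ∈? block 𝒬 j)) (home j)

  misplaced≡sum : ∀ j → misplaced j ≡ ∑[ x < n ] misplacedAt j x
  misplaced≡sum j with home j
  ... | just i = ∣p∣≡sum-𝟙∈ (block 𝒬 j ─ block 𝒫 i)
  ... | nothing = sym (sum-zero {n} (λ _ → 0) λ _ → refl)

  unhomed≡sum : ∀ j → unhomed j ≡ ∑[ x < n ] unhomedAt j x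
  unhomed≡sum j with home j
  ... | just _ = sym (sum-zero {n} (λ _ → 0) λ _ → refl)
  ... | nothing = ∣p∣≡sum-𝟙∈ (block 𝒬 j)

  misplacedAt-outside : ∀ j x → x ∉ block 𝒬 j → misplacedAt j x ≡ 0
  misplacedAt-outside j x x∉Q with home j
  ... | just i =
    𝟙-no (x ∈? block 𝒬 j ─ block 𝒫 i) (x∉Q ∘ proj₁ ∘ x∈p─q⁻ (block 𝒬 j) (block 𝒫 i))
  ... | nothing = refl

  unhomedAt-outside : ∀ j x → x ∉ block 𝒬 j → unhomedAt j x ≡ 0
  unhomedAt-outside j x x∉Q with home j
  ... | just _ = refl
  ... | nothing = 𝟙-no (x ∈? block 𝒬 j) x∉Q

  stray? : ∀ x i → Dec (x ∈ block 𝒫 i △ gathered i)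
  stray? x i = x ∈? block 𝒫 i △ gathered i

  stray⁻ : ∀ {i x} → x ∈ block 𝒫 i △ gathered i →
           (i ≡ blockOf 𝒫 x × home (blockOf 𝒬 x) ≢ just i) ⊎
           (home (blockOf 𝒬 x) ≡ just i × i ≢ blockOf 𝒫 x)
  stray⁻ {i} x∈△ with x∈p△q⁻ (block 𝒫 i) (gathered i) x∈△
  ... | inj₁ (x∈P , x∉U) = inj₁ (blockOf-unique 𝒫 x∈P , x∉U ∘ ∈-gathered⁺)
  ... | inj₂ (x∈U , x∉P) = inj₂ (∈-gathered⁻ x∈U , λ { refl → x∉P (∈-blockOf 𝒫 _) })

  sum-stray-≤ : ∀ x → ∑[ i < k 𝒫 ] 𝟙 (stray? x i)
                        ≤ 2 ℕ.* misplacedAt (blockOf 𝒬 x) x ℕ.+ unhomedAt (blockOf 𝒬 x) x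
  sum-stray-≤ x with home (blockOf 𝒬 x) in homeₓ
  ... | nothing = subst (∑[ i < k 𝒫 ] 𝟙 (stray? x i) ≤_) (sym (𝟙-yes (x ∈? Qₓ) (∈-blockOf 𝒬 x)))
                    (sum-𝟙-≤1 (stray? x) (blockOf 𝒫 x) own-block)
    where
    Qₓ : Subset n
    Qₓ = block 𝒬 (blockOf 𝒬 x)
    own-block : ∀ i → x ∈ block 𝒫 i △ gathered i → i ≡ blockOf 𝒫 x
    own-block i x∈△ with stray⁻ x∈△
    ... | inj₁ (i≡P , _) = i≡P
    ... | inj₂ (homed , _) with trans (sym homeₓ) homed
    ...   | ()
  ... | just h with h ≟ blockOf 𝒫 x
  ...   | yes refl = subst (_≤ _) (sym (sum-𝟙-none (stray? x) no-stray)) ℕ.z≤n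
    where
    no-stray : ∀ i → x ∉ block 𝒫 i △ gathered i
    no-stray i x∈△ with stray⁻ x∈△
    ... | inj₁ (refl , unhomed) = unhomed homeₓ
    ... | inj₂ (homed , i≢P) = i≢P (just-injective (trans (sym homed) homeₓ))
  ...   | no h≢P = subst (∑[ i < k 𝒫 ] 𝟙 (stray? x i) ≤_) (cong (λ m → 2 ℕ.* m ℕ.+ 0) (sym 𝟙-misplaced))
                     (sum-𝟙-≤2 (stray? x) (blockOf 𝒫 x) h own-or-home)
    where
    Qₓ─P : Subset n
    Qₓ─P = block 𝒬 (blockOf 𝒬 x) ─ block 𝒫 h
    𝟙-misplaced : 𝟙 (x ∈? Qₓ─P) ≡ 1
    𝟙-misplaced = 𝟙-yes (x ∈? Qₓ─P) (x∈p∧x∉q⇒x∈p─q (∈-blockOf 𝒬 x) (h≢P ∘ blockOf-unique 𝒫))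
    own-or-home : ∀ i → x ∈ block 𝒫 i △ gathered i → i ≡ blockOf 𝒫 x ⊎ i ≡ h
    own-or-home i x∈△ with stray⁻ x∈△
    ... | inj₁ (i≡P , _) = inj₁ i≡P
    ... | inj₂ (homed , _) = inj₂ (just-injective (trans (sym homed) homeₓ))

  sum-∣block△gathered∣≤2*misplaced+unhomed : ∑[ i < k 𝒫 ] ∣ block 𝒫 i △ gathered i ∣
                           ≤ 2 ℕ.* ∑[ j < k 𝒬 ] misplaced j ℕ.+ ∑[ j < k 𝒬 ] unhomed j
  sum-∣block△gathered∣≤2*misplaced+unhomed = begin
    ∑[ i < k 𝒫 ] ∣ block 𝒫 i △ gathered i ∣
      ≡⟨ sum-cong-≗ (λ i → ∣p∣≡sum-𝟙∈ (block 𝒫 i △ gathered i)) ⟩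
    ∑[ i < k 𝒫 ] ∑[ x < n ] 𝟙 (stray? x i)
      ≡⟨ ∑-comm (λ i x → 𝟙 (stray? x i)) ⟩
    ∑[ x < n ] ∑[ i < k 𝒫 ] 𝟙 (stray? x i)
      ≤⟨ sum-mono-≤ sum-stray-≤ ⟩
    ∑[ x < n ] (2 ℕ.* m x ℕ.+ u x)
      ≡⟨ ∑-distrib-+ (λ x → 2 ℕ.* m x) u ⟩
    ∑[ x < n ] (2 ℕ.* m x) ℕ.+ ∑[ x < n ] u x
      ≡⟨ cong (ℕ._+ ∑[ x < n ] u x) (*-distribˡ-sum 2 m) ⟨
    2 ℕ.* ∑[ x < n ] m x ℕ.+ ∑[ x < n ] u x
      ≡⟨ cong₂ (λ a b → 2 ℕ.* a ℕ.+ b) (sum-over-blocks 𝒬 misplacedAt misplacedAt-outside)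
                                          (sum-over-blocks 𝒬 unhomedAt unhomedAt-outside) ⟨
    2 ℕ.* ∑[ j < k 𝒬 ] ∑[ x < n ] misplacedAt j x ℕ.+ ∑[ j < k 𝒬 ] ∑[ x < n ] unhomedAt j x
      ≡⟨ cong₂ (λ a b → 2 ℕ.* a ℕ.+ b) (sum-cong-≗ misplaced≡sum) (sum-cong-≗ unhomed≡sum) ⟨
    2 ℕ.* ∑[ j < k 𝒬 ] misplaced j ℕ.+ ∑[ j < k 𝒬 ] unhomed j
      ∎
    where
    open ℕP.≤-Reasoning
    m u : Fin n → ℕ
    m x = misplacedAt (blockOf 𝒬 x) x
    u x = unhomedAt (blockOf 𝒬 x) x

three-times : ∀ c q → (+ 3 / 1) * c * q ≡ c * q +ℚ c * q +ℚ c * q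
three-times c q = begin
  (+ 3 / 1) * c * q             ≡⟨ cong (_* q) (ℚP.*-distribʳ-+ c (1ℚ +ℚ 1ℚ) 1ℚ) ⟩
  ((1ℚ +ℚ 1ℚ) * c +ℚ 1ℚ * c) * q ≡⟨ cong (λ t → (t +ℚ 1ℚ * c) * q) (ℚP.*-distribʳ-+ c 1ℚ 1ℚ) ⟩
  (1ℚ * c +ℚ 1ℚ * c +ℚ 1ℚ * c) * q ≡⟨ cong (λ t → (t +ℚ t +ℚ t) * q) (ℚP.*-identityˡ c) ⟩
  (c +ℚ c +ℚ c) * q             ≡⟨ ℚP.*-distribʳ-+ q (c +ℚ c) c ⟩
  (c +ℚ c) * q +ℚ c * q         ≡⟨ cong (_+ℚ c * q) (ℚP.*-distribʳ-+ q c c) ⟩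
  c * q +ℚ c * q +ℚ c * q       ∎
  where open ≡-Reasoning

module _ {n} (𝒫 𝒬 : Partition n) (δ : ℚ) where

  home-of : ∀ S → Dec (S ∈⟨ δ ⟩ 𝒫) → Maybe (Fin (k 𝒫))
  home-of _ (yes (i , _)) = just i
  home-of _ (no _) = nothing

  δ-home : Fin (k 𝒬) → Maybe (Fin (k 𝒫))
  δ-home j = home-of (block 𝒬 j) (block 𝒬 j ∈⟨ δ ⟩? 𝒫)

  open HomeAssignment 𝒫 𝒬 δ-home

  -- The decision is matched through a helper rather than by with-abstraction, which would
  -- normalise the goal and unfold toℚ's gcd on open terms.
  misplaced-≤ : 0ℚ ≤ℚ δ → ∀ j → toℚ (misplaced j) ≤ℚ δ * toℚ ∣ block 𝒬 j ∣
  misplaced-≤ δ≥0 j = by-decision (block 𝒬 j ∈⟨ δ ⟩? 𝒫)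
    where
    by-decision : (Q∈? : Dec (block 𝒬 j ∈⟨ δ ⟩ 𝒫)) →
                  toℚ (maybe′ (λ i → ∣ block 𝒬 j ─ block 𝒫 i ∣) 0 (home-of (block 𝒬 j) Q∈?))
                    ≤ℚ δ * toℚ ∣ block 𝒬 j ∣
    by-decision (yes (_ , Q⊆P)) = ℚP.<⇒≤ Q⊆P
    by-decision (no _) = subst (_≤ℚ δ * toℚ ∣ block 𝒬 j ∣) (ℚP.*-zeroʳ δ)
                           (ℚP.*-monoˡ-≤-nonNeg δ {{nonNegative δ≥0}} (toℚ-nonNeg ∣ block 𝒬 j ∣))

  unhomed-≡ : ∀ j → unhomed j ≡ (if does (block 𝒬 j ∈⟨ δ ⟩? 𝒫) then 0 else ∣ block 𝒬 j ∣)
  unhomed-≡ j = by-decision (block 𝒬 j ∈⟨ δ ⟩? 𝒫)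
    where
    by-decision : (Q∈? : Dec (block 𝒬 j ∈⟨ δ ⟩ 𝒫)) →
                  maybe′ (λ _ → 0) ∣ block 𝒬 j ∣ (home-of (block 𝒬 j) Q∈?)
                    ≡ (if does Q∈? then 0 else ∣ block 𝒬 j ∣)
    by-decision (yes _) = refl
    by-decision (no _) = refl

  sum-unhomed-≤ : 𝒬 ≺⟨ δ ⟩ 𝒫 → toℚ (∑[ j < k 𝒬 ] unhomed j) ≤ℚ δ * toℚ n
  sum-unhomed-≤ 𝒬≺𝒫 = subst (λ s → toℚ s ≤ℚ δ * toℚ n)
    (trans (sum-allFin (λ j → if does (block 𝒬 j ∈⟨ δ ⟩? 𝒫) then 0 else ∣ block 𝒬 j ∣))
           (sym (sum-cong-≗ unhomed-≡)))
    𝒬≺𝒫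

  sum-misplaced-≤ : 0ℚ ≤ℚ δ → toℚ (∑[ j < k 𝒬 ] misplaced j) ≤ℚ δ * toℚ n
  sum-misplaced-≤ δ≥0 = subst (λ s → toℚ (∑[ j < k 𝒬 ] misplaced j) ≤ℚ δ * toℚ s) (sum-∣block∣ 𝒬)
    (∀-≤-scaled⇒sum-≤-scaled δ misplaced (λ j → ∣ block 𝒬 j ∣) (misplaced-≤ δ≥0))

  sum-∣block△gathered∣≤3δ*sum-∣block∣ : 0 ℕ.< n → 𝒬 ≺⟨ δ ⟩ 𝒫 →
    toℚ (∑[ i < k 𝒫 ] ∣ block 𝒫 i △ gathered i ∣)
      ≤ℚ (+ 3 / 1) * δ * toℚ (∑[ i < k 𝒫 ] ∣ block 𝒫 i ∣)
  sum-∣block△gathered∣≤3δ*sum-∣block∣ n>0 𝒬≺𝒫 = begin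
    toℚ (∑[ i < k 𝒫 ] ∣ block 𝒫 i △ gathered i ∣)
      ≤⟨ toℚ-mono-≤ sum-∣block△gathered∣≤2*misplaced+unhomed ⟩
    toℚ (2 ℕ.* M ℕ.+ B)
      ≡⟨ toℚ-2*+ ⟩
    toℚ M +ℚ toℚ M +ℚ toℚ B
      ≤⟨ ℚP.+-mono-≤ (ℚP.+-mono-≤ M≤ M≤) B≤ ⟩
    δ * toℚ n +ℚ δ * toℚ n +ℚ δ * toℚ n
      ≡⟨ three-times δ (toℚ n) ⟨
    (+ 3 / 1) * δ * toℚ n
      ≡⟨ cong (λ s → (+ 3 / 1) * δ * toℚ s) (sum-∣block∣ 𝒫) ⟨
    (+ 3 / 1) * δ * toℚ (∑[ i < k 𝒫 ] ∣ block 𝒫 i ∣) ∎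
    where
    open ℚP.≤-Reasoning
    M B : ℕ
    M = ∑[ j < k 𝒬 ] misplaced j
    B = ∑[ j < k 𝒬 ] unhomed j
    B≤ : toℚ B ≤ℚ δ * toℚ n
    B≤ = sum-unhomed-≤ 𝒬≺𝒫
    M≤ : toℚ M ≤ℚ δ * toℚ n
    M≤ = sum-misplaced-≤ (nonNeg-from-scaled (toℚ-pos n n>0) (ℚP.≤-trans (toℚ-nonNeg B) B≤))
    toℚ-2*+ : toℚ (2 ℕ.* M ℕ.+ B) ≡ toℚ M +ℚ toℚ M +ℚ toℚ B
    toℚ-2*+ = begin-equality
      toℚ (2 ℕ.* M ℕ.+ B)        ≡⟨ cong (λ t → toℚ (M ℕ.+ t ℕ.+ B)) (ℕP.+-identityʳ M) ⟩
      toℚ (M ℕ.+ M ℕ.+ B)        ≡⟨ toℚ-+ (M ℕ.+ M) B ⟩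
      toℚ (M ℕ.+ M) +ℚ toℚ B     ≡⟨ cong (_+ℚ toℚ B) (toℚ-+ M M) ⟩
      toℚ M +ℚ toℚ M +ℚ toℚ B    ∎

claim2 : (n : ℕ) → 1 ≤ n → (𝒫 𝒬 : Partition n) → (δ : ℚ) →
    𝒬 ≺⟨ δ ⟩ 𝒫 →
    ∃[ i ] ∃[ I ] toℚ ∣ block 𝒫 i △ unionOf 𝒬 I ∣ ≤ℚ (+ 3 / 1) * δ * toℚ ∣ block 𝒫 i ∣
claim2 n 1≤n 𝒫 𝒬 δ 𝒬≺𝒫 =
  let i , close = sum-≤-scaled⇒∃-≤-scaled ((+ 3 / 1) * δ)
                    (λ i → ∣ block 𝒫 i △ gathered i ∣) (λ i → ∣ block 𝒫 i ∣)
                    (blockOf 𝒫 (fromℕ< 1≤n))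
                    (sum-∣block△gathered∣≤3δ*sum-∣block∣ 𝒫 𝒬 δ 1≤n 𝒬≺𝒫)
  in i , homedAt i , close
  where open HomeAssignment 𝒫 𝒬 (δ-home 𝒫 𝒬 δ)
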